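{- Let $(N,m,m')$ be a reachability problem with $N=(S,T,F)$, let $\Omega$ be a total order on $\mathbb{N}^T$ as in the context, and let $b$ be the $\Omega$-smallest solution in $\mathbb{N}^T$ of the state equation $m+Cx=m'$. Let $ps'=((c_j)_{1\le j\le \ell},x',\sigma',0)$ be a full solution of the problem. Then for each $0\le n\le\ell$ there is a partial solution $ps_n=((c_j)_{1\le j\le n},x_n,\sigma_n,r_n)$ such that $ps_0=(\emptyset,b,\sigma_0,r_0)$, $ps_\ell=ps'$, and $x_{n_1}\le_\Omega x_{n_2}$ whenever $n_1\le n_2$.
   Context: A Petri net is $N=(S,T,F)$ with finite disjoint nonempty sets $S$ (places), $T$ (transitions) and $F\colon (S\times T)\cup(T\times S)\to\mathbb{N}$. A marking is $m\colon S\to\mathbb{N}$; $t$ is enabled under $m$ if $m(s)\ge F(s,t)$ for all $s$, and firing it yields $m'(s)=m(s)-F(s,t)+F(t,s)$. Firing sequences $\sigma\in T^*$ under $m$ are defined inductively as usual. A reachability problem is a triple $(N,m,m')$ of a net and two markings. The Parikh image $\wp(\sigma)\in\mathbb{N}^T$ counts occurrences of each transition in $\sigma$. The incidence matrix is $C_{s,t}=F(t,s)-F(s,t)$ and the state equation is $m+Cx=m'$, $x\in\mathbb{N}^T$. A jump constraint is an inequality $t<n$ with $t\in T$, $n\in\mathbb{N}$; an increment constraint is an inequality $\sum_{i=1}^k n_i t_i\ge n$ with $n_i\in\mathbb{Z}$, $n\in\mathbb{N}$, $t_i\in T$; a vector satisfies a constraint if the inequality holds after substituting its entries. Fix a total order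 $\Omega$ on $\mathbb{N}^T$ such that $\sum_t x(t)<\sum_t y(t)$ implies $x<_\Omega y$. A partial solution of $(N,m,m')$ is a tuple $(\Gamma,x,\sigma,r)$ where $\Gamma$ is a finite family of jump and increment constraints, $x$ is the $\Omega$-smallest vector in $\mathbb{N}^T$ satisfying the state equation and all constraints of $\Gamma$, $\sigma$ is a firing sequence under $m$ with $\wp(\sigma)\le x$ componentwise, $r=x-\wp(\sigma)$, and for every $t$ with $r(t)>0$, $\sigma t$ is not a firing sequence under $m$. A full solution is a partial solution with $r=0$. -}

module Defs where

open import Level using (0ℓ)
open import Data.Nat using (ℕ; zero; suc; _+_; _∸_; _≤_; _<_)
open import Data.Integer as ℤ using (ℤ; +_)
open import Data.Fin using (Fin; zero; suc)
open import Data.Fin.Properties using (_≟_)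
open import Data.List using (List; []; _∷_; _++_; [_])
open import Data.Product using (_×_; _,_; ∃)
open import Data.Sum using (_⊎_)
open import Relation.Nullary using (¬_; yes; no)
open import Relation.Binary using (Rel; IsStrictTotalOrder)
open import Relation.Binary.PropositionalEquality using (_≡_; _≗_)

sumℕ : ∀ {n} → (Fin n → ℕ) → ℕ
sumℕ {zero}  f = 0
sumℕ {suc n} f = f zero + sumℕ (λ i → f (suc i))

sumℤ : ∀ {n} → (Fin n → ℤ) → ℤ
sumℤ {zero}  f = + 0
sumℤ {suc n} f = f zero ℤ.+ sumℤ (λ i → f (suc i))

-- A Petri net with places Fin nS and transitions Fin nT.
-- pre s t = F(s,t), post t s = F(t,s).
record Net (nS nT : ℕ) : Set where
  field
    pre  : Fin nS → Fin nT → ℕ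
    post : Fin nT → Fin nS → ℕ

Marking : ℕ → Set
Marking nS = Fin nS → ℕ

Vect : ℕ → Set
Vect nT = Fin nT → ℕ

record Omega (nT : ℕ) : Set₁ where
  field
    _<Ω_    : Rel (Vect nT) 0ℓ
    isSTO   : IsStrictTotalOrder _≗_ _<Ω_
    sumMono : ∀ x y → sumℕ x < sumℕ y → x <Ω y

  _≤Ω_ : Vect nT → Vect nT → Set
  x ≤Ω y = x <Ω y ⊎ x ≗ y

data Constraint (nT : ℕ) : Set where
  jump : Fin nT → ℕ → Constraint nT
  incr : List (ℤ × Fin nT) → ℕ → Constraint nT

linSum : ∀ {nT} → List (ℤ × Fin nT) → Vect nT → ℤ
linSum []            x = + 0
linSum ((k , t) ∷ l) x = k ℤ.* (+ x t) ℤ.+ linSum l x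

Satisfies : ∀ {nT} → Vect nT → Constraint nT → Set
Satisfies x (jump t n) = x t < n
Satisfies x (incr l n) = + n ℤ.≤ linSum l x

SatisfiesAll : ∀ {nT} → Vect nT → List (Constraint nT) → Set
SatisfiesAll x []      = Data.Unit.⊤ where import Data.Unit
SatisfiesAll x (c ∷ Γ) = Satisfies x c × SatisfiesAll x Γ

parikh : ∀ {nT} → List (Fin nT) → Vect nT
parikh []      t = 0
parikh (u ∷ σ) t with u ≟ t
... | yes _ = suc (parikh σ t)
... | no  _ = parikh σ t

module _ {nS nT : ℕ} (N : Net nS nT) where
  open Net N

  Enabled : Marking nS → Fin nT → Set
  Enabled m t = ∀ s → pre s t ≤ m s

  fire : Marking nS → Fin nT → Marking nS
  fire m t s = m s ∸ pre s t + post t s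

  data Fires : Marking nS → List (Fin nT) → Marking nS → Set where
    fires-[] : ∀ {m} → Fires m [] m
    fires-∷  : ∀ {m t σ m''} → Enabled m t → Fires (fire m t) σ m'' →
               Fires m (t ∷ σ) m''

  FiringSeq : Marking nS → List (Fin nT) → Set
  FiringSeq m σ = ∃ λ m'' → Fires m σ m''

  C : Fin nS → Fin nT → ℤ
  C s t = + post t s ℤ.- + pre s t

  StateEq : Marking nS → Marking nS → Vect nT → Set
  StateEq m m' x = ∀ s → + m s ℤ.+ sumℤ (λ t → C s t ℤ.* + x t) ≡ + m' s

  module _ (Ω : Omega nT) (m m' : Marking nS) where
    open Omega Ω

    IsΩMin : (Vect nT → Set) → Vect nT → Set
    IsΩMin P x = P x × (∀ y → P y → x ≤Ω y)

    record PartialSolution (Γ : List (Constraint nT)) (x : Vect nT)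
                           (σ : List (Fin nT)) (r : Vect nT) : Set where
      field
        minimal   : IsΩMin (λ y → StateEq m m' y × SatisfiesAll y Γ) x
        firing    : FiringSeq m σ
        parikh≤   : ∀ t → parikh σ t ≤ x t
        remainder : ∀ t → r t ≡ x t ∸ parikh σ t
        stuck     : ∀ t → 0 < r t → ¬ FiringSeq m (σ ++ [ t ])

    FullSolution : List (Constraint nT) → Vect nT → List (Fin nT) → Set
    FullSolution Γ x σ = PartialSolution Γ x σ (λ _ → 0)

module Submission where

-- For n < ℓ the partial solution ps_n uses the prefix c_1 … c_n: its vector
-- x_n is the Ω-least solution of the state equation under these constraints,
-- and its firing sequence σ_n is obtained by firing transitions greedily as
-- long as the remainder x_n − ℘(σ_n) permits; ps_ℓ is ps' itself.
--   * Ω-least elements exist: x' is a solution, and every vector Ω-below it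
--     has component sum at most Σ x' (Ω extends the sum order), so it lies in
--     a finite box of vectors; the Ω-minimum of the solutions in that box is
--     Ω-least among all solutions.
--   * Greedy firing terminates because the total remainder strictly drops.
--   * x_0 ≗ b because Ω-least elements of equivalent predicates coincide, and
--     x_{n₁} ≤Ω x_{n₂} for n₁ ≤ n₂ because a longer prefix of constraints
--     implies a shorter one.

open import Defs
open import Level using (0ℓ)
open import Data.Nat using (ℕ; zero; suc; _∸_; _≤_; _<_; _≤?_; _<?_; z≤n; s≤s)
open import Data.Nat.Properties
  using (+-mono-≤; +-mono-<-≤; +-mono-≤-<; m≤m+n; m≤n+m; ≤-refl; ≤-reflexive; ≤-trans; <-≤-trans;
         ≤-pred; n<1+n; n≤1+n; ≰⇒>; ∸-monoʳ-≤; ∸-monoʳ-<; m∸n≢0⇒n<m; n>0⇒n≢0; m≤n⇒m⊓n≡m)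
  renaming (_≟_ to _≟ℕ_)
open import Data.Integer as ℤ using (ℤ; +_)
open import Data.Fin using (Fin; zero; suc)
open import Data.Fin.Properties using (all?; any?) renaming (_≟_ to _≟F_)
open import Data.Vec.Functional as Vector using (tail)
open import Data.List using (List; []; _∷_; _++_; [_]; take; length; filter; upTo; cartesianProductWith)
open import Data.List.Properties using (take-take; take-all)
open import Data.List.Membership.Propositional using (_∈_)
open import Data.List.Membership.Propositional.Properties using (∈-cartesianProductWith⁺; ∈-upTo⁺; ∈-filter⁺)
open import Data.List.Relation.Unary.Any using (here)
open import Data.List.Relation.Unary.All using (lookup)
open import Data.List.Relation.Unary.All.Properties using (all-filter)
open import Data.Product using (Σ; _×_; _,_; proj₁; proj₂; ∃)
open import Data.Sum using (inj₁)
open import Data.Unit using (tt)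
open import Data.Empty using (⊥-elim)
open import Function using (id; _∘_)
open import Relation.Nullary using (¬_; Dec; yes; no)
open import Relation.Nullary.Decidable using (_×-dec_)
open import Relation.Unary using (Decidable)
open import Relation.Binary using (TotalOrder)
import Relation.Binary.Construct.StrictToNonStrict as StrictToNonStrict
open import Relation.Binary.PropositionalEquality
  using (_≡_; _≢_; _≗_; refl; sym; trans; cong; cong₂; subst)

sumℕ-mono : ∀ {n} {f g : Fin n → ℕ} → (∀ i → f i ≤ g i) → sumℕ f ≤ sumℕ g
sumℕ-mono {zero}  f≤g = z≤n
sumℕ-mono {suc n} f≤g = +-mono-≤ (f≤g zero) (sumℕ-mono (f≤g ∘ suc))

sumℕ-strict : ∀ {n} {f g : Fin n → ℕ} → (∀ i → f i ≤ g i) → ∀ i → f i < g i → sumℕ f < sumℕ g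
sumℕ-strict {suc n} f≤g zero    fi<gi = +-mono-<-≤ fi<gi (sumℕ-mono (f≤g ∘ suc))
sumℕ-strict {suc n} f≤g (suc i) fi<gi = +-mono-≤-< (f≤g zero) (sumℕ-strict (f≤g ∘ suc) i fi<gi)

entry≤sumℕ : ∀ {n} (f : Fin n → ℕ) i → f i ≤ sumℕ f
entry≤sumℕ f zero    = m≤m+n (f zero) _
entry≤sumℕ f (suc i) = ≤-trans (entry≤sumℕ (tail f) i) (m≤n+m _ (f zero))

sumℤ-cong : ∀ {n} {f g : Fin n → ℤ} → f ≗ g → sumℤ f ≡ sumℤ g
sumℤ-cong {zero}  f≗g = refl
sumℤ-cong {suc n} f≗g = cong₂ ℤ._+_ (f≗g zero) (sumℤ-cong (f≗g ∘ suc))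

box : (n K : ℕ) → List (Vect n)
box zero    K = [ Vector.[] ]
box (suc n) K = cartesianProductWith Vector._∷_ (upTo (suc K)) (box n K)

box-complete : ∀ n K (y : Vect n) → (∀ i → y i ≤ K) → ∃ λ z → z ∈ box n K × z ≗ y
box-complete zero    K y y≤K = Vector.[] , here refl , λ ()
box-complete (suc n) K y y≤K =
  y zero Vector.∷ z , ∈-cartesianProductWith⁺ Vector._∷_ (∈-upTo⁺ (s≤s (y≤K zero))) z∈box , head∷z≗y
  where
    tail-in-box = box-complete n K (tail y) (y≤K ∘ suc)
    z = proj₁ tail-in-box
    z∈box = proj₁ (proj₂ tail-in-box)

    head∷z≗y : (y zero Vector.∷ z) ≗ y
    head∷z≗y zero    = refl
    head∷z≗y (suc i) = proj₂ (proj₂ tail-in-box) i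

module LeastElements {nT : ℕ} (Ω : Omega nT) where
  open Omega Ω

  ≤Ω-totalOrder : TotalOrder 0ℓ 0ℓ 0ℓ
  ≤Ω-totalOrder = record
    { Carrier = Vect nT ; _≈_ = _≗_ ; _≤_ = _≤Ω_
    ; isTotalOrder = StrictToNonStrict.isTotalOrder _≗_ _<Ω_ isSTO }

  open TotalOrder ≤Ω-totalOrder using (antisym) renaming (trans to ≤Ω-trans; ≤-respʳ-≈ to ≤Ω-respʳ)
  open import Data.List.Extrema ≤Ω-totalOrder using (min; min≤⊤; min≤xs; argmin-all)

  Least : (Vect nT → Set) → Vect nT → Set
  Least P x = P x × (∀ y → P y → x ≤Ω y)

  least-mono : ∀ {P Q x y} → (∀ z → Q z → P z) → Least P x → Least Q y → x ≤Ω y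
  least-mono Q⇒P (_ , x-least) (qy , _) = x-least _ (Q⇒P _ qy)

  least-unique : ∀ {P Q x y} → (∀ z → P z → Q z) → (∀ z → Q z → P z) → Least P x → Least Q y → x ≗ y
  least-unique P⇒Q Q⇒P lx ly = antisym (least-mono Q⇒P lx ly) (least-mono P⇒Q ly lx)

  -- A decidable, ≗-invariant, inhabited predicate has an Ω-least element: the
  -- minimum of a witness w and of the elements of P in the box bounded by Σ w.
  -- Vectors outside that box have larger sum, hence lie Ω-above w.
  least-exists : ∀ {P} → Decidable P → (∀ {a b} → a ≗ b → P a → P b) → ∀ {w} → P w → ∃ (Least P)
  least-exists {P} P? P-resp {w} pw = μ , argmin-all id pw (all-filter P? (box nT (sumℕ w))) , μ-below
    where
      candidates : List (Vect nT)
      candidates = filter P? (box nT (sumℕ w))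

      μ : Vect nT
      μ = min w candidates

      μ-below : ∀ y → P y → μ ≤Ω y
      μ-below y py with sumℕ y ≤? sumℕ w
      ... | yes Σy≤Σw = ≤Ω-respʳ z≗y (lookup (min≤xs w candidates) z∈candidates)
        where
          in-box = box-complete nT (sumℕ w) y (λ i → ≤-trans (entry≤sumℕ y i) Σy≤Σw)
          z = proj₁ in-box
          z≗y = proj₂ (proj₂ in-box)
          z∈candidates = ∈-filter⁺ P? (proj₁ (proj₂ in-box)) (P-resp (sym ∘ z≗y) py)
      ... | no Σy≰Σw = ≤Ω-trans (min≤⊤ w candidates) (inj₁ (sumMono w y (≰⇒> Σy≰Σw)))

linSum-cong : ∀ {nT} {a b : Vect nT} → a ≗ b → ∀ l → linSum l a ≡ linSum l b
linSum-cong a≗b []            = refl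
linSum-cong a≗b ((k , t) ∷ l) = cong₂ ℤ._+_ (cong (λ v → k ℤ.* + v) (a≗b t)) (linSum-cong a≗b l)

satisfiesAll-resp : ∀ {nT} {a b : Vect nT} → a ≗ b → ∀ Γ → SatisfiesAll a Γ → SatisfiesAll b Γ
satisfiesAll-resp a≗b []             tt        = tt
satisfiesAll-resp a≗b (jump t n ∷ Γ) (sat , Γ-sat) = subst (_< n) (a≗b t) sat , satisfiesAll-resp a≗b Γ Γ-sat
satisfiesAll-resp a≗b (incr l n ∷ Γ) (sat , Γ-sat) =
  subst (+ n ℤ.≤_) (linSum-cong a≗b l) sat , satisfiesAll-resp a≗b Γ Γ-sat

satisfiesAll? : ∀ {nT} (y : Vect nT) Γ → Dec (SatisfiesAll y Γ)
satisfiesAll? y []             = yes tt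
satisfiesAll? y (jump t n ∷ Γ) = (y t <? n) ×-dec satisfiesAll? y Γ
satisfiesAll? y (incr l n ∷ Γ) = (+ n ℤ.≤? linSum l y) ×-dec satisfiesAll? y Γ

satisfiesAll-take : ∀ {nT} {y : Vect nT} n Γ → SatisfiesAll y Γ → SatisfiesAll y (take n Γ)
satisfiesAll-take zero    Γ       _             = tt
satisfiesAll-take (suc n) []      _             = tt
satisfiesAll-take (suc n) (c ∷ Γ) (sat , Γ-sat) = sat , satisfiesAll-take n Γ Γ-sat

satisfiesAll-prefix : ∀ {nT} {y : Vect nT} {n₁ n₂} Γ → n₁ ≤ n₂
  → SatisfiesAll y (take n₂ Γ) → SatisfiesAll y (take n₁ Γ)
satisfiesAll-prefix {y = y} {n₁} {n₂} Γ n₁≤n₂ sat =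
  subst (SatisfiesAll y) prefix-of-prefix (satisfiesAll-take n₁ (take n₂ Γ) sat)
  where
    prefix-of-prefix : take n₁ (take n₂ Γ) ≡ take n₁ Γ
    prefix-of-prefix = trans (take-take n₁ n₂ Γ) (cong (λ k → take k Γ) (m≤n⇒m⊓n≡m n₁≤n₂))

parikh-snoc-self : ∀ {nT} (σ : List (Fin nT)) t → parikh (σ ++ [ t ]) t ≡ suc (parikh σ t)
parikh-snoc-self [] t with t ≟F t
... | yes _   = refl
... | no  t≢t = ⊥-elim (t≢t refl)
parikh-snoc-self (v ∷ σ) t with v ≟F t
... | yes _ = cong suc (parikh-snoc-self σ t)
... | no  _ = parikh-snoc-self σ t

parikh-snoc-other : ∀ {nT} (σ : List (Fin nT)) {t u} → t ≢ u → parikh (σ ++ [ t ]) u ≡ parikh σ u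
parikh-snoc-other [] {t} {u} t≢u with t ≟F u
... | yes t≡u = ⊥-elim (t≢u t≡u)
... | no  _   = refl
parikh-snoc-other (v ∷ σ) {u = u} t≢u with v ≟F u
... | yes _ = cong suc (parikh-snoc-other σ t≢u)
... | no  _ = parikh-snoc-other σ t≢u

parikh-snoc-≥ : ∀ {nT} (σ : List (Fin nT)) t u → parikh σ u ≤ parikh (σ ++ [ t ]) u
parikh-snoc-≥ σ t u with t ≟F u
... | yes refl = subst (parikh σ t ≤_) (sym (parikh-snoc-self σ t)) (n≤1+n _)
... | no  t≢u = ≤-reflexive (sym (parikh-snoc-other σ t≢u))

module Firing {nS nT : ℕ} (N : Net nS nT) where

  fires-snoc : ∀ {m σ k t} → Fires N m σ k → Enabled N k t → Fires N m (σ ++ [ t ]) (fire N k t)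
  fires-snoc fires-[]      enabled = fires-∷ enabled fires-[]
  fires-snoc (fires-∷ e f) enabled = fires-∷ e (fires-snoc f enabled)

  snoc-enabled : ∀ {m σ k t k'} → Fires N m σ k → Fires N m (σ ++ [ t ]) k' → Enabled N k t
  snoc-enabled fires-[]      (fires-∷ enabled _) = enabled
  snoc-enabled (fires-∷ _ f) (fires-∷ _ f')      = snoc-enabled f f'

  record Saturated (m : Marking nS) (x : Vect nT) (σ : List (Fin nT)) : Set where
    field
      firing  : FiringSeq N m σ
      bounded : ∀ t → parikh σ t ≤ x t
      stuck   : ∀ t → parikh σ t < x t → ¬ FiringSeq N m (σ ++ [ t ])

  module _ (m : Marking nS) (x : Vect nT) where

    residual : List (Fin nT) → Vect nT
    residual σ t = x t ∸ parikh σ t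

    Bounded : List (Fin nT) → Set
    Bounded σ = ∀ t → parikh σ t ≤ x t

    bounded-snoc : ∀ {σ t} → parikh σ t < x t → Bounded σ → Bounded (σ ++ [ t ])
    bounded-snoc {σ} {t} available bounded u with t ≟F u
    ... | yes refl = subst (_≤ x t) (sym (parikh-snoc-self σ t)) available
    ... | no  t≢u  = subst (_≤ x u) (sym (parikh-snoc-other σ t≢u)) (bounded u)

    residual-snoc : ∀ {σ t} → parikh σ t < x t → Bounded σ
      → sumℕ (residual (σ ++ [ t ])) < sumℕ (residual σ)
    residual-snoc {σ} {t} available bounded =
      sumℕ-strict (λ u → ∸-monoʳ-≤ (x u) (parikh-snoc-≥ σ t u)) t
        (∸-monoʳ-< (subst (parikh σ t <_) (sym (parikh-snoc-self σ t)) (n<1+n _))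
                   (bounded-snoc {σ} available bounded t))

    available? : ∀ σ k → Dec (∃ λ t → parikh σ t < x t × Enabled N k t)
    available? σ k = any? (λ t → (parikh σ t <? x t) ×-dec all? (λ s → Net.pre N s t ≤? k s))

    -- Fire available enabled transitions until there are none; the fuel
    -- bounds the total residual, which drops at every step.
    saturate : ∀ fuel σ {k} → Fires N m σ k → Bounded σ → sumℕ (residual σ) < fuel → ∃ (Saturated m x)
    saturate zero       σ     f bounded ()
    saturate (suc fuel) σ {k} f bounded residual<fuel with available? σ k
    ... | yes (t , available , enabled) =
      saturate fuel (σ ++ [ t ]) (fires-snoc f enabled) (bounded-snoc {σ} available bounded)
        (<-≤-trans (residual-snoc {σ} available bounded) (≤-pred residual<fuel))
    ... | no none = σ , record
      { firing  = _ , f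
      ; bounded = bounded
      ; stuck   = λ t available (_ , f') → none (t , available , snoc-enabled f f') }

    saturated-exists : ∃ (Saturated m x)
    saturated-exists = saturate (suc (sumℕ x)) [] fires-[] (λ _ → z≤n) (s≤s ≤-refl)

module PartialSolutions {nS nT : ℕ} (N : Net nS nT) (Ω : Omega nT) (m m' : Marking nS) where
  open LeastElements Ω
  open Firing N

  stateEq-resp : ∀ {a b} → a ≗ b → StateEq N m m' a → StateEq N m m' b
  stateEq-resp a≗b a-sol s =
    trans (cong (ℤ._+_ (+ m s)) (sumℤ-cong (λ t → cong (λ v → C N s t ℤ.* + v) (sym (a≗b t))))) (a-sol s)

  stateEq? : ∀ y → Dec (StateEq N m m' y)
  stateEq? y = all? (λ s → (+ m s ℤ.+ sumℤ (λ t → C N s t ℤ.* + y t)) ℤ.≟ + m' s)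

  Admissible : List (Constraint nT) → Vect nT → Set
  Admissible Γ y = StateEq N m m' y × SatisfiesAll y Γ

  PartialSolutionFor : List (Constraint nT) → Set
  PartialSolutionFor Γ =
    Σ (Vect nT) λ x → Σ (List (Fin nT)) λ σ → Σ (Vect nT) λ r → PartialSolution N Ω m m' Γ x σ r

  partialSolution-exists : ∀ Γ {w} → Admissible Γ w → PartialSolutionFor Γ
  partialSolution-exists Γ w-admissible = x , σ , residual m x σ , record
    { minimal   = x-least
    ; firing    = firing
    ; parikh≤   = bounded
    ; remainder = λ _ → refl
    ; stuck     = λ t remaining → stuck t (m∸n≢0⇒n<m (n>0⇒n≢0 remaining)) }
    where
      x-exists = least-exists (λ y → stateEq? y ×-dec satisfiesAll? y Γ)
        (λ a≗b (a-sol , a-sat) → stateEq-resp a≗b a-sol , satisfiesAll-resp a≗b Γ a-sat) w-admissible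
      x = proj₁ x-exists
      x-least = proj₂ x-exists
      σ-saturated = saturated-exists m x
      σ = proj₁ σ-saturated
      open Saturated (proj₂ σ-saturated)

lemma3p4 : {nS nT : ℕ} → 1 ≤ nS → 1 ≤ nT → (N : Net nS nT) → (Ω : Omega nT)
    → (m m' : Marking nS) → (b : Vect nT)
    → IsΩMin N Ω m m' (StateEq N m m') b
    → (Γ' : List (Constraint nT)) (x' : Vect nT) (σ' : List (Fin nT))
    → FullSolution N Ω m m' Γ' x' σ'
    → Σ (ℕ → Vect nT) λ xs → Σ (ℕ → List (Fin nT)) λ σs → Σ (ℕ → Vect nT) λ rs
      → (∀ n → n ≤ length Γ' → PartialSolution N Ω m m' (take n Γ') (xs n) (σs n) (rs n))
      × (xs 0 ≗ b)
      × ((xs (length Γ') ≗ x') × (σs (length Γ') ≡ σ') × (rs (length Γ') ≗ (λ _ → 0)))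
      × (∀ n₁ n₂ → n₁ ≤ n₂ → n₂ ≤ length Γ' → Omega._≤Ω_ Ω (xs n₁) (xs n₂))
lemma3p4 {nT = nT} _ _ N Ω m m' b b-least Γ' x' σ' full = xs , σs , rs , (λ n _ → isPartial n) , base , top , monotone
  where
    open Omega Ω using (_≤Ω_)
    open LeastElements Ω
    open PartialSolutions N Ω m m'
    open PartialSolution using (minimal)

    ℓ = length Γ'

    solutionAt : ∀ n → Dec (n ≡ ℓ) → PartialSolutionFor (take n Γ')
    solutionAt n (yes n≡ℓ) =
      x' , σ' , (λ _ → 0) , subst (λ Γ → FullSolution N Ω m m' Γ x' σ') Γ'-is-prefix full
      where
        Γ'-is-prefix : Γ' ≡ take n Γ'
        Γ'-is-prefix = sym (take-all n Γ' (≤-reflexive (sym n≡ℓ)))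
    solutionAt n (no _) = partialSolution-exists (take n Γ') (x'-solves , satisfiesAll-take n Γ' x'-satisfies)
      where
        x'-solves = proj₁ (proj₁ (minimal full))
        x'-satisfies = proj₂ (proj₁ (minimal full))

    solution : ∀ n → PartialSolutionFor (take n Γ')
    solution n = solutionAt n (n ≟ℕ ℓ)

    xs : ℕ → Vect nT
    xs n = proj₁ (solution n)
    σs : ℕ → List (Fin nT)
    σs n = proj₁ (proj₂ (solution n))
    rs : ℕ → Vect nT
    rs n = proj₁ (proj₂ (proj₂ (solution n)))
    isPartial : ∀ n → PartialSolution N Ω m m' (take n Γ') (xs n) (σs n) (rs n)
    isPartial n = proj₂ (proj₂ (proj₂ (solution n)))

    -- With no constraints, x_0 and b are Ω-least for the same predicate.
    base : xs 0 ≗ b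
    base = least-unique (λ _ → proj₁) (λ _ sol → sol , tt) (minimal (isPartial 0)) b-least

    top-is-full : ∀ d → let (x , σ , r , _) = solutionAt ℓ d in (x ≗ x') × (σ ≡ σ') × (r ≗ λ _ → 0)
    top-is-full (yes _)   = (λ _ → refl) , refl , (λ _ → refl)
    top-is-full (no ℓ≢ℓ) = ⊥-elim (ℓ≢ℓ refl)

    top : (xs ℓ ≗ x') × (σs ℓ ≡ σ') × (rs ℓ ≗ (λ _ → 0))
    top = top-is-full (ℓ ≟ℕ ℓ)

    -- The constraints of a longer prefix imply those of a shorter one.
    monotone : ∀ n₁ n₂ → n₁ ≤ n₂ → n₂ ≤ ℓ → xs n₁ ≤Ω xs n₂
    monotone n₁ n₂ n₁≤n₂ _ = least-mono (λ y (sol , sat) → sol , satisfiesAll-prefix Γ' n₁≤n₂ sat)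
      (minimal (isPartial n₁)) (minimal (isPartial n₂))
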